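{- Let $G$ be a finite connected graph. Then $c_H(G)=1$ if and only if $G$ is a tree.
   Context: Hyperopic Cops and Robbers on a finite connected simple graph $G$: one player controls $k$ cops, the other a single robber. The cops first choose starting vertices (several cops may share a vertex), then the robber chooses a starting vertex; afterwards, in each round, each cop moves to an adjacent vertex or stays put, and then the robber moves to an adjacent vertex or stays put. The robber always knows the cops' positions. The robber is invisible to the cops exactly when the robber's vertex is adjacent to the vertex of every cop (a robber on the same vertex as a cop is visible); otherwise the cops see the robber's position. The cops win if after finitely many rounds some cop occupies the robber's vertex, and the cops' strategy must guarantee this with certainty (no chance: the final move must surely land a cop on the robber regardless of where an invisible robber might be). The hyperopic cop number $c_H(G)$ is the minimum $k$ for which $k$ cops have a winning strategy. -}

module Defs where

open import Data.Nat using (ℕ; zero; suc; pred; _≤_; _<_)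
open import Data.Fin using (Fin)
open import Data.Fin.Properties using (all?)
open import Data.Bool using (Bool; T; true; false)
open import Data.Maybe using (Maybe; just; nothing)
open import Data.List using (List; []; _∷_; length; _∷ʳ_)
open import Data.List.Relation.Unary.Linked using (Linked)
open import Data.List.Relation.Unary.Unique.Propositional using (Unique)
open import Data.Product using (Σ; _×_; ∃)
open import Data.Sum using (_⊎_)
open import Relation.Nullary using (¬_; yes; no)
open import Relation.Nullary.Decidable using (T?)
open import Relation.Binary.PropositionalEquality using (_≡_)

record Graph (n : ℕ) : Set where
  field
    adj    : Fin n → Fin n → Bool
    sym    : ∀ u v → adj u v ≡ adj v u
    irrefl : ∀ v → adj v v ≡ false

  Adj : Fin n → Fin n → Set
  Adj u v = T (adj u v)

open Graph public

module _ {n : ℕ} (G : Graph n) where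

  data Walk : Fin n → Fin n → Set where
    here : ∀ {u} → Walk u u
    step : ∀ {u v w} → Adj G u v → Walk v w → Walk u w

  Connected : Set
  Connected = ∀ u v → Walk u v

  record Cycle : Set where
    field
      v        : Fin n
      ws       : List (Fin n)
      long     : 2 ≤ length ws
      distinct : Unique (v ∷ ws)
      edges    : Linked (Adj G) ((v ∷ ws) ∷ʳ v)

  IsTree : Set
  IsTree = Connected × ¬ Cycle

  Step : Fin n → Fin n → Set
  Step u v = u ≡ v ⊎ Adj G u v

module _ {n : ℕ} (G : Graph n) (k : ℕ) where

  Config : Set
  Config = Fin k → Fin n

  -- What the cops observe: the robber's position if visible, nothing if
  -- the robber is adjacent to every cop (invisible).
  Obs : Set
  Obs = Maybe (Fin n)

  observe : Config → Fin n → Obs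
  observe c r with all? (λ i → T? (adj G (c i) r))
  ... | yes _ = nothing
  ... | no  _ = just r

  -- A deterministic cop strategy: initial positions, and the next
  -- positions as a function of the observation history (most recent
  -- observation first). (Cops' own positions are determined by these.)
  record Strategy : Set where
    field
      start : Config
      move  : List Obs → Config

  open Strategy public

  module Play (σ : Strategy) (r : ℕ → Fin n) where
    -- cops t : cop positions after the cops' move of round t (start at t = 0)
    -- hist t : observations o_t ∷ ... ∷ o_0, o_t made after robber's move to r t
    cops : ℕ → Config
    hist : ℕ → List Obs
    cops zero    = start σ
    cops (suc t) = move σ (hist t)
    hist zero    = observe (cops zero) (r zero) ∷ []
    hist (suc t) = observe (cops (suc t)) (r (suc t)) ∷ hist t

    LegalCopMove : ℕ → Set
    LegalCopMove t = ∀ j → Step G (cops t j) (cops (suc t) j)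

    -- capture at time t: a cop at time t sits on the robber's vertex
    -- either before the robber's reply (r (pred t)) or after it (r t)
    Caught : ℕ → Set
    Caught t = ∃ λ j → cops t j ≡ r t ⊎ cops t j ≡ r (pred t)

  RobberWalk : (ℕ → Fin n) → Set
  RobberWalk r = ∀ t → Step G (r t) (r (suc t))

  CopsWin : Set
  CopsWin = Σ Strategy λ σ → Σ ℕ λ N → ∀ r → RobberWalk r →
    Σ ℕ λ t → t ≤ N × Play.Caught σ r t × (∀ s → s < t → Play.LegalCopMove σ r s)

HyperopicCopNumber : ∀ {n} → Graph n → ℕ → Set
HyperopicCopNumber G k = CopsWin G k × (∀ j → j < k → ¬ CopsWin G j)

module Submission where

-- On a cycle the robber can always reach three distinct vertices: his own and his two
-- neighbours along the cycle.  Against one cop at least one of them is safe: a vertex the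
-- cop cannot reach in one move is safe, and the cop's neighbours, where the robber is
-- invisible, all receive the same reply, which lands on at most one of them.
--
-- In an acyclic graph every edge joins a vertex to its breadth-first parent.  The cop starts
-- at a deepest vertex ℓ, which is a leaf, and works in the breadth-first tree rooted at ℓ.
-- It keeps the robber strictly below itself and knows his position, stepping each round to
-- its child towards him: when he is invisible he is a child of the cop, and the only child he
-- can have reached is the one towards his previous position.  The cop's depth grows by one
-- per round, so the robber is caught within the height of the tree.

open import Defs
open import Data.Nat using (ℕ; _≤_)
open import Function.Bundles using (_⇔_)

open import Function.Bundles using (mk⇔)
open import Data.Nat using (zero; suc; pred; _<_; _+_; _∸_; z≤n; s≤s; _≤′_; ≤′-refl; ≤′-step)
open import Data.Nat.Properties
  using ( ≤-refl; ≤-reflexive; ≤-trans; ≤-antisym; ≤-total; ≤-pred; ≤⇒≤′; <⇒≤; <-irrefl; <-asym; ≰⇒>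
        ; 1+n≰n; n≤0⇒n≡0; m≤n⇒m<n∨m≡n; m≤n⇒m≤1+n; m≤n+m; +-suc; +-identityʳ; m+n∸n≡m )
open import Data.Fin using (Fin; zero; _≟_)
open import Data.Fin.Properties using (any?; all?)
open import Data.Bool using (T)
open import Data.Maybe using (just; nothing)
open import Data.List using (List; []; _∷_; _∷ʳ_; length; allFin)
open import Data.List.Base using (InitLast; initLast; _∷ʳ′_)
open import Data.List.Relation.Unary.All as All using (All; []; _∷_)
open import Data.List.Relation.Unary.All.Properties using (∷ʳ⁺; ∷ʳ⁻)
open import Data.List.Relation.Unary.AllPairs using ([]; _∷_)
open import Data.List.Relation.Unary.Linked using (Linked; []; [-]; _∷_)
open import Data.List.Relation.Unary.Unique.Propositional using (Unique)
open import Data.List.Relation.Binary.Permutation.Propositional using (_↭_; ↭-sym; ↭⇒↭ₛ)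
open import Data.List.Relation.Binary.Permutation.Propositional.Properties using (∷↭∷ʳ)
import Data.List.Relation.Binary.Permutation.Setoid.Properties as PermutationSetoid
open import Data.List.Membership.Propositional.Properties using (∈-allFin)
open import Data.List.Extrema.Nat using (argmax; f[xs]≤f[argmax])
open import Data.Product as Product using (Σ; ∃; _×_; _,_; proj₁; proj₂)
open import Data.Sum as Sum using (_⊎_; inj₁; inj₂; [_,_]′)
open import Data.Empty using (⊥-elim)
open import Function.Base using (_∘_)
open import Relation.Nullary using (¬_; Dec; yes; no)
open import Relation.Nullary.Decidable using (T?; _×-dec_; _⊎-dec_)
open import Relation.Unary using (Decidable)
open import Relation.Binary.PropositionalEquality
  using (_≡_; _≢_; refl; trans; cong; subst; subst₂; setoid)
import Relation.Binary.PropositionalEquality as ≡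

private
  variable
    A : Set
    R : A → A → Set
    x y z : A
    xs ys : List A

linked-∷ʳ⁺ : Linked R (xs ∷ʳ x) → R x y → Linked R (xs ∷ʳ x ∷ʳ y)
linked-∷ʳ⁺ {xs = []}              [-]     r = r ∷ [-]
linked-∷ʳ⁺ {xs = _ ∷ ws@[]}       (s ∷ l) r = s ∷ linked-∷ʳ⁺ {xs = ws} l r
linked-∷ʳ⁺ {xs = _ ∷ ws@(_ ∷ _)}  (s ∷ l) r = s ∷ linked-∷ʳ⁺ {xs = ws} l r

linked-∷ʳ⁻ : Linked R (xs ∷ʳ x ∷ʳ y) → Linked R (xs ∷ʳ x) × R x y
linked-∷ʳ⁻ {xs = []}             (r ∷ [-]) = [-] , r
linked-∷ʳ⁻ {xs = _ ∷ ws@[]}      (s ∷ l)   = Product.map₁ (s ∷_) (linked-∷ʳ⁻ {xs = ws} l)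
linked-∷ʳ⁻ {xs = _ ∷ ws@(_ ∷ _)} (s ∷ l)   = Product.map₁ (s ∷_) (linked-∷ʳ⁻ {xs = ws} l)

2≤length-∷ʳ-∷ʳ : 2 ≤ length (xs ∷ʳ x ∷ʳ y)
2≤length-∷ʳ-∷ʳ {xs = []}     = s≤s (s≤s z≤n)
2≤length-∷ʳ-∷ʳ {xs = _ ∷ ws} = m≤n⇒m≤1+n (2≤length-∷ʳ-∷ʳ {xs = ws})

0<length-∷ʳ : 0 < length (xs ∷ʳ x)
0<length-∷ʳ {xs = []}    = s≤s z≤n
0<length-∷ʳ {xs = _ ∷ _} = s≤s z≤n

unique-↭ : xs ↭ ys → Unique xs → Unique ys
unique-↭ p = PermutationSetoid.Unique-resp-↭ (setoid _) (↭⇒↭ₛ p)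

unique-extend : x ≢ y → All (x ≢_) xs → All (y ≢_) xs → Unique xs → Unique (x ∷ xs ∷ʳ y)
unique-extend {xs = xs} x≢y x∉ y∉ u = ∷ʳ⁺ x∉ x≢y ∷ unique-↭ (∷↭∷ʳ _ xs) (y∉ ∷ u)

module _ {P : ℕ → Set} (monotone : ∀ {k} → P k → P (suc k)) where

  monotone-≤ : ∀ {j k} → j ≤ k → P j → P k
  monotone-≤ j≤k = go (≤⇒≤′ j≤k)
    where
    go : ∀ {j k} → j ≤′ k → P j → P k
    go ≤′-refl       p = p
    go (≤′-step j≤k) p = monotone (go j≤k p)

  least-monotone : Decidable P → ∀ {K} → P K → ∃ λ k → P k × (∀ {j} → P j → k ≤ j)
  least-monotone P? {zero}  p = 0 , p , λ _ → z≤n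
  least-monotone P? {suc K} p with P? K
  ... | yes q = least-monotone P? q
  ... | no ¬q = suc K , p , λ {j} q → ≰⇒> (λ j≤K → ¬q (monotone-≤ j≤K q))

module _ {n : ℕ} (G : Graph n) where

  adj-irrefl : ∀ {v} → ¬ Adj G v v
  adj-irrefl {v} = subst T (irrefl G v)

  adj-sym : ∀ {u v} → Adj G u v → Adj G v u
  adj-sym {u} {v} = subst T (sym G u v)

  adj⇒≢ : ∀ {u v} → Adj G u v → u ≢ v
  adj⇒≢ a refl = adj-irrefl a

  step? : ∀ u v → Dec (Step G u v)
  step? u v = (u ≟ v) ⊎-dec T? (adj G u v)

  module _ {k : ℕ} where

    -- f o is the cops' next configuration after they observe o.
    Safe : Config G k → (Obs G k → Config G k) → Fin n → Set
    Safe c f x = ∀ j → c j ≢ x × (Step G (c j) (f (observe G k c x) j) → f (observe G k c x) j ≢ x)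

    outside-safe : ∀ {c f x} → (∀ j → ¬ Step G (c j) x) → Safe c f x
    outside-safe far j = (λ e → far j (inj₁ e)) , λ st e → far j (subst (Step G _) e st)

    Evasive : {S : Set} → (S → Fin n) → Set
    Evasive {S} position =
      ∀ s c f → Σ S λ s₁ → Step G (position s) (position s₁) × Safe c f (position s₁)

    module Flee (σ : Strategy G k) {S : Set} (position : S → Fin n) (s₀ : S)
                (escape : Evasive position) where

      copsAfter : List (Obs G k) → Config G k
      copsAfter []        = start σ
      copsAfter h@(_ ∷ _) = move σ h

      reply : List (Obs G k) → Obs G k → Config G k
      reply h o = move σ (o ∷ h)

      -- the robber's state at time t, and the observations made before time t
      flee : ℕ → S × List (Obs G k)
      flee zero    = proj₁ (escape s₀ (copsAfter []) (reply [])) , []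
      flee (suc t) = proj₁ (escape s (copsAfter h₁) (reply h₁)) , h₁
        where
        s = proj₁ (flee t)
        h₁ = observe G k (copsAfter (proj₂ (flee t))) (position s) ∷ proj₂ (flee t)

      robber : ℕ → Fin n
      robber t = position (proj₁ (flee t))

      open Play G k σ robber

      robber-walk : RobberWalk G k robber
      robber-walk t = proj₁ (proj₂ (escape _ _ _))

      robber-safe : ∀ t → Safe (copsAfter (proj₂ (flee t))) (reply (proj₂ (flee t))) (robber t)
      robber-safe zero    = proj₂ (proj₂ (escape _ _ _))
      robber-safe (suc t) = proj₂ (proj₂ (escape _ _ _))

      hist-flee : ∀ t → hist t ≡ proj₂ (flee (suc t))
      hist-flee zero    = refl
      hist-flee (suc t) rewrite hist-flee t = refl

      cops-flee : ∀ t → cops t ≡ copsAfter (proj₂ (flee t))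
      cops-flee zero    = refl
      cops-flee (suc t) = cong (move σ) (hist-flee t)

      never-caught : ∀ t → (∀ s → s < t → LegalCopMove s) → ¬ Caught t
      never-caught t legal (j , inj₁ caught) =
        proj₁ (robber-safe t j) (trans (cong (λ c → c j) (≡.sym (cops-flee t))) caught)
      never-caught zero legal (j , inj₂ caught) = proj₁ (robber-safe zero j) caught
      never-caught (suc t) legal (j , inj₂ caught) =
        proj₂ (robber-safe t j)
          (subst₂ (λ c c₁ → Step G (c j) (c₁ j)) (cops-flee t) (cops-flee (suc t)) (legal t ≤-refl j))
          (trans (cong (λ c → c j) (≡.sym (cops-flee (suc t)))) caught)

    evasive⇒¬CopsWin : {S : Set} (position : S → Fin n) → S → Evasive position → ¬ CopsWin G k
    evasive⇒¬CopsWin position s₀ escape (σ , _ , wins) =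
      let t , _ , caught , legal = wins robber robber-walk in never-caught t legal caught
      where open Flee σ position s₀ escape

  -- Evading one cop on a cycle

  module _ {c : Config G 1} where

    observe-hidden : ∀ {x} → Adj G (c zero) x → observe G 1 c x ≡ nothing
    observe-hidden {x} a with all? (λ i → T? (adj G (c i) x))
    ... | yes _ = refl
    ... | no ¬all = ⊥-elim (¬all λ { zero → a })

    observe-visible : ∀ {x} → ¬ Adj G (c zero) x → observe G 1 c x ≡ just x
    observe-visible {x} na with all? (λ i → T? (adj G (c i) x))
    ... | yes all = ⊥-elim (na (all zero))
    ... | no _    = refl

  module _ {c : Config G 1} {f : Obs G 1 → Config G 1} where

    hidden-safe : ∀ {x} → Adj G (c zero) x → f nothing zero ≢ x → Safe c f x
    hidden-safe a ne zero rewrite observe-hidden {c = c} a = adj⇒≢ a , λ _ → ne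

    hidden-pair-safe : ∀ {x y} → Adj G (c zero) x → Adj G (c zero) y → x ≢ y → Safe c f x ⊎ Safe c f y
    hidden-pair-safe {x} ax ay x≢y with f nothing zero ≟ x
    ... | no ne    = inj₁ (hidden-safe ax ne)
    ... | yes refl = inj₂ (hidden-safe ay x≢y)

    close-safe : ∀ {x y z} → Step G (c zero) x → Step G (c zero) y → Step G (c zero) z →
                 x ≢ y → y ≢ z → x ≢ z → Safe c f x ⊎ Safe c f y ⊎ Safe c f z
    close-safe (inj₁ refl) (inj₁ refl) _           x≢y _   _   = ⊥-elim (x≢y refl)
    close-safe (inj₁ refl) (inj₂ _)    (inj₁ refl) _   _   x≢z = ⊥-elim (x≢z refl)
    close-safe (inj₁ refl) (inj₂ ay)   (inj₂ az)   _   y≢z _   = inj₂ (hidden-pair-safe ay az y≢z)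
    close-safe (inj₂ _)    (inj₁ refl) (inj₁ refl) _   y≢z _   = ⊥-elim (y≢z refl)
    close-safe (inj₂ ax)   (inj₁ refl) (inj₂ az)   _   _   x≢z =
      [ inj₁ , inj₂ ∘ inj₂ ]′ (hidden-pair-safe ax az x≢z)
    close-safe (inj₂ ax)   (inj₂ ay)   _           x≢y _   _   = Sum.map₂ inj₁ (hidden-pair-safe ax ay x≢y)

    safe-among-three : ∀ {x y z} → x ≢ y → y ≢ z → x ≢ z → Safe c f x ⊎ Safe c f y ⊎ Safe c f z
    safe-among-three {x} {y} {z} x≢y y≢z x≢z
      with step? (c zero) x | step? (c zero) y | step? (c zero) z
    ... | no far | _      | _      = inj₁ (outside-safe {f = f} λ { zero → far })
    ... | yes _  | no far | _      = inj₂ (inj₁ (outside-safe {f = f} λ { zero → far }))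
    ... | yes _  | yes _  | no far = inj₂ (inj₂ (outside-safe {f = f} λ { zero → far }))
    ... | yes sx | yes sy | yes sz = close-safe sx sy sz x≢y y≢z x≢z

  record Exits (v : Fin n) : Set where
    field
      ahead behind : Cycle G
      adj-ahead    : Adj G v (Cycle.v ahead)
      adj-behind   : Adj G v (Cycle.v behind)
      ahead≢behind : Cycle.v ahead ≢ Cycle.v behind

  exits : (C : Cycle G) → Exits (Cycle.v C)
  exits C = around (initLast (Cycle.ws C)) (Cycle.long C) (Cycle.distinct C) (Cycle.edges C)
    where
    around : ∀ {v ws} → InitLast ws → 2 ≤ length ws → Unique (v ∷ ws) →
             Linked (Adj G) ((v ∷ ws) ∷ʳ v) → Exits v
    around []           ()
    around ([] ∷ʳ′ _)   (s≤s ())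
    around {v} ((w ∷ us) ∷ʳ′ x) _ distinct@(_ ∷ (w∉ ∷ _)) edges@(vw ∷ edges₁) = record
      { ahead = record
          { v        = w
          ; ws       = us ∷ʳ x ∷ʳ v
          ; long     = 2≤length-∷ʳ-∷ʳ {xs = us}
          ; distinct = unique-↭ (∷↭∷ʳ v (w ∷ us ∷ʳ x)) distinct
          ; edges    = linked-∷ʳ⁺ {xs = w ∷ us ∷ʳ x} edges₁ vw
          }
      ; behind = record
          { v        = x
          ; ws       = v ∷ w ∷ us
          ; long     = s≤s (s≤s z≤n)
          ; distinct = unique-↭ (↭-sym (∷↭∷ʳ x (v ∷ w ∷ us))) distinct
          ; edges    = proj₂ closing ∷ proj₁ closing
          }
      ; adj-ahead    = vw
      ; adj-behind   = adj-sym (proj₂ closing)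
      ; ahead≢behind = proj₂ (∷ʳ⁻ w∉)
      }
      where
      closing : Linked (Adj G) (v ∷ w ∷ us ∷ʳ x) × Adj G x v
      closing = linked-∷ʳ⁻ {xs = v ∷ w ∷ us} edges

  cycle-evasive : Evasive {k = 1} Cycle.v
  cycle-evasive C c f =
    [ (λ safe → C , inj₁ refl , safe)
    , [ (λ safe → ahead , inj₂ adj-ahead , safe) , (λ safe → behind , inj₂ adj-behind , safe) ]′
    ]′ (safe-among-three {c = c} {f = f} (adj⇒≢ adj-ahead) ahead≢behind (adj⇒≢ adj-behind))
    where open Exits (exits C)

  cycle⇒¬CopsWin : Cycle G → ¬ CopsWin G 1
  cycle⇒¬CopsWin C = evasive⇒¬CopsWin Cycle.v C cycle-evasive

  -- Breadth-first trees

  record BreadthFirstTree (root : Fin n) : Set where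
    field
      depth        : Fin n → ℕ
      parent       : Fin n → Fin n
      depth-root   : depth root ≡ 0
      depth≡0⇒root : ∀ {v} → depth v ≡ 0 → v ≡ root
      adj-parent   : ∀ {v} → v ≢ root → Adj G v (parent v)
      depth-parent : ∀ v → depth (parent v) ≡ pred (depth v)
      depth-adj    : ∀ {u v} → Adj G u v → depth v ≤ suc (depth u)

  module BreadthFirstSearch (connected : Connected G) (root : Fin n) where

    Within : ℕ → Fin n → Set
    Within zero    v = v ≡ root
    Within (suc k) v = Within k v ⊎ ∃ λ u → Within k u × Adj G u v

    within? : ∀ k → Decidable (Within k)
    within? zero    v = v ≟ root
    within? (suc k) v = within? k v ⊎-dec any? (λ u → within? k u ×-dec T? (adj G u v))

    walk⇒within : ∀ {k u v} → Walk G u v → Within k u → ∃ λ m → Within m v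
    walk⇒within here       w = _ , w
    walk⇒within (step a p) w = walk⇒within p (inj₂ (_ , w , a))

    layer : ∀ v → ∃ λ k → Within k v × (∀ {j} → Within j v → k ≤ j)
    layer v = least-monotone inj₁ (λ k → within? k v) (proj₂ (walk⇒within (connected root v) refl))

    depth : Fin n → ℕ
    depth v = proj₁ (layer v)

    within-depth : ∀ v → Within (depth v) v
    within-depth v = proj₁ (proj₂ (layer v))

    depth-least : ∀ {j v} → Within j v → depth v ≤ j
    depth-least {v = v} = proj₂ (proj₂ (layer v))

    depth-adj : ∀ {u v} → Adj G u v → depth v ≤ suc (depth u)
    depth-adj {u} a = depth-least (inj₂ (u , within-depth u , a))

    upward : ∀ v → v ≢ root → ∃ λ u → Adj G v u × suc (depth u) ≡ depth v
    upward v v≢root with depth v in eq | within-depth v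
    ... | zero  | w                = ⊥-elim (v≢root w)
    ... | suc k | inj₁ w           = ⊥-elim (1+n≰n (subst (_≤ k) eq (depth-least w)))
    ... | suc k | inj₂ (u , w , a) =
      u , adj-sym a , cong suc (≤-antisym (depth-least w) (≤-pred (subst (_≤ suc (depth u)) eq (depth-adj a))))

    parent : Fin n → Fin n
    parent v with v ≟ root
    ... | yes _    = root
    ... | no v≢root = proj₁ (upward v v≢root)

    tree : BreadthFirstTree root
    tree = record
      { depth        = depth
      ; parent       = parent
      ; depth-root   = depth-root
      ; depth≡0⇒root = λ {v} e → subst (λ k → Within k v) e (within-depth v)
      ; adj-parent   = adj-parent
      ; depth-parent = depth-parent
      ; depth-adj    = depth-adj
      }
      where
      depth-root : depth root ≡ 0
      depth-root = n≤0⇒n≡0 (depth-least refl)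

      adj-parent : ∀ {v} → v ≢ root → Adj G v (parent v)
      adj-parent {v} v≢root with v ≟ root
      ... | yes v≡root = ⊥-elim (v≢root v≡root)
      ... | no  v≢root = proj₁ (proj₂ (upward v v≢root))

      depth-parent : ∀ v → depth (parent v) ≡ pred (depth v)
      depth-parent v with v ≟ root
      ... | yes refl   = trans depth-root (≡.sym (cong pred depth-root))
      ... | no  v≢root = cong pred (proj₂ (proj₂ (upward v v≢root)))

  module InTree {root : Fin n} (T : BreadthFirstTree root) where
    open BreadthFirstTree T

    deep⇒≢root : ∀ {v k} → depth v ≡ suc k → v ≢ root
    deep⇒≢root e refl with () ← trans (≡.sym e) depth-root

    depth-nonroot : ∀ {v} → v ≢ root → depth v ≡ suc (depth (parent v))
    depth-nonroot {v} v≢root with depth v in e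
    ... | zero  = ⊥-elim (v≢root (depth≡0⇒root e))
    ... | suc k = cong suc (≡.sym (trans (depth-parent v) (cong pred e)))

    child⇒≢root : ∀ {x y} → Adj G x y → parent y ≡ x → y ≢ root
    child⇒≢root a refl refl = adj-irrefl (subst (λ v → Adj G v root) parent-root a)
      where
      parent-root : parent root ≡ root
      parent-root = depth≡0⇒root (trans (depth-parent root) (cong pred depth-root))

    depth-child : ∀ {x y} → Adj G x y → parent y ≡ x → depth y ≡ suc (depth x)
    depth-child a refl = depth-nonroot (child⇒≢root a refl)

    deepest : Fin n
    deepest = argmax depth root (allFin n)

    depth≤deepest : ∀ v → depth v ≤ depth deepest
    depth≤deepest v = All.lookup (f[xs]≤f[argmax] root (allFin n)) (∈-allFin v)

    shallower-∉ : ∀ {x k vs} → depth x ≡ k → All (λ v → suc k ≤ depth v) vs → All (x ≢_) vs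
    shallower-∉ refl = All.map λ { deeper refl → 1+n≰n deeper }

    -- Climb from both ends of the path, one level at a time, until the parents coincide.
    high-path⇒cycle : ∀ k {a b} I → depth a ≡ k → depth b ≡ k → Linked (Adj G) (a ∷ I ∷ʳ b) →
                      Unique (a ∷ I ∷ʳ b) → All (λ v → k ≤ depth v) (a ∷ I ∷ʳ b) → Cycle G
    high-path⇒cycle zero I da db _ (a∉ ∷ _) _ =
      ⊥-elim (proj₂ (∷ʳ⁻ a∉) (trans (depth≡0⇒root da) (≡.sym (depth≡0⇒root db))))
    high-path⇒cycle (suc k) {a} {b} I da db path distinct high with parent a ≟ parent b
    ... | yes pa≡pb = record
      { v        = parent a
      ; ws       = a ∷ I ∷ʳ b
      ; long     = s≤s (0<length-∷ʳ {xs = I})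
      ; distinct = shallower-∉ dpa high ∷ distinct
      ; edges    = adj-sym (adj-parent a≢root)
                   ∷ linked-∷ʳ⁺ {xs = a ∷ I} path (subst (Adj G b) (≡.sym pa≡pb) (adj-parent b≢root))
      }
      where
      a≢root = deep⇒≢root da
      b≢root = deep⇒≢root db
      dpa = trans (depth-parent a) (cong pred da)
    ... | no pa≢pb = high-path⇒cycle k (a ∷ I ∷ʳ b) dpa dpb
      (adj-sym (adj-parent (deep⇒≢root da)) ∷ linked-∷ʳ⁺ {xs = a ∷ I} path (adj-parent (deep⇒≢root db)))
      (unique-extend pa≢pb (shallower-∉ dpa high) (shallower-∉ dpb high) distinct)
      (≤-reflexive (≡.sym dpa) ∷ ∷ʳ⁺ (All.map <⇒≤ high) (≤-reflexive (≡.sym dpb)))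
      where
      dpa = trans (depth-parent a) (cong pred da)
      dpb = trans (depth-parent b) (cong pred db)

    ancestor : ℕ → Fin n → Fin n
    ancestor zero    v = v
    ancestor (suc k) v = ancestor k (parent v)

    depth-ancestor : ∀ k {v d} → depth v ≡ k + d → depth (ancestor k v) ≡ d
    depth-ancestor zero    e = e
    depth-ancestor (suc k) {v} e = depth-ancestor k (trans (depth-parent v) (cong pred e))

    parent-ancestor : ∀ k v → parent (ancestor k v) ≡ ancestor (suc k) v
    parent-ancestor zero    v = refl
    parent-ancestor (suc k) v = parent-ancestor k (parent v)

    record ProperAncestor (c x : Fin n) : Set where
      constructor proper-ancestor
      field
        gap          : ℕ
        depth-gap    : depth x ≡ suc gap + depth c
        ancestor-gap : ancestor (suc gap) x ≡ c

    ancestor-deeper : ∀ {c x} → ProperAncestor c x → depth c < depth x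
    ancestor-deeper {c} (proper-ancestor g e _) = subst (depth c <_) (≡.sym e) (s≤s (m≤n+m (depth c) g))

    root-ancestor : ∀ {x} → x ≢ root → ProperAncestor root x
    root-ancestor {x} x≢root = proper-ancestor (depth (parent x)) dx
      (depth≡0⇒root (trans (depth-ancestor (suc (depth (parent x))) dx) depth-root))
      where
      dx : depth x ≡ suc (depth (parent x)) + depth root
      dx = trans (depth-nonroot x≢root)
             (≡.sym (trans (cong (suc (depth (parent x)) +_) depth-root) (+-identityʳ _)))

    childTowards : Fin n → Fin n → Fin n
    childTowards c x = ancestor (depth x ∸ suc (depth c)) x

    childTowards-at : ∀ k {c x} → depth x ≡ k + suc (depth c) → childTowards c x ≡ ancestor k x
    childTowards-at k {c} {x} e =
      cong (λ m → ancestor m x) (trans (cong (_∸ suc (depth c)) e) (m+n∸n≡m k (suc (depth c))))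

    module _ {c x} (pa : ProperAncestor c x) where
      open ProperAncestor pa

      childTowards-gap : childTowards c x ≡ ancestor gap x
      childTowards-gap = childTowards-at gap (trans depth-gap (≡.sym (+-suc gap (depth c))))

      depth-childTowards : depth (childTowards c x) ≡ suc (depth c)
      depth-childTowards = trans (cong depth childTowards-gap)
        (depth-ancestor gap (trans depth-gap (≡.sym (+-suc gap (depth c)))))

      parent-childTowards : parent (childTowards c x) ≡ c
      parent-childTowards = trans (cong parent childTowards-gap) (trans (parent-ancestor gap x) ancestor-gap)

      adj-childTowards : Adj G c (childTowards c x)
      adj-childTowards =
        adj-sym (subst (Adj G _) parent-childTowards (adj-parent (deep⇒≢root depth-childTowards)))

    childTowards-ancestor : ∀ {c x} (pa : ProperAncestor c x) → childTowards c x ≢ x →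
                            ProperAncestor (childTowards c x) x
    childTowards-ancestor pa@(proper-ancestor zero _ _) ne = ⊥-elim (ne (childTowards-gap pa))
    childTowards-ancestor {c} pa@(proper-ancestor (suc g) e _) _ = proper-ancestor g
      (trans e (trans (cong suc (≡.sym (+-suc g (depth c))))
                      (cong (suc g +_) (≡.sym (depth-childTowards pa)))))
      (≡.sym (childTowards-gap pa))

    module Acyclic (acyclic : ¬ Cycle G) where

      ParentEdge : Fin n → Fin n → Set
      ParentEdge u v = parent u ≡ v ⊎ parent v ≡ u

      downward-adj⇒parent-edge : ∀ {u v} → Adj G u v → depth u ≤ depth v → ParentEdge u v
      downward-adj⇒parent-edge {u} {v} a u≤v with parent u ≟ v | parent v ≟ u
      ... | yes pu≡v | _       = inj₁ pu≡v
      ... | no _     | yes pv≡u = inj₂ pv≡u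
      ... | no _     | no pv≢u  = ⊥-elim (acyclic (cycle (m≤n⇒m<n∨m≡n u≤v)))
        where
        cycle : depth u < depth v ⊎ depth u ≡ depth v → Cycle G
        cycle (inj₂ du≡dv) =
          high-path⇒cycle (depth u) [] refl (≡.sym du≡dv) (a ∷ [-])
            ((adj⇒≢ a ∷ []) ∷ [] ∷ []) (≤-refl ∷ u≤v ∷ [])
        cycle (inj₁ du<dv) =
          high-path⇒cycle (depth u) (v ∷ []) refl dpv (a ∷ adj-parent v≢root ∷ [-])
            ((adj⇒≢ a ∷ pv≢u ∘ ≡.sym ∷ []) ∷ (adj⇒≢ (adj-parent v≢root) ∷ []) ∷ [] ∷ [])
            (≤-refl ∷ u≤v ∷ ≤-reflexive (≡.sym dpv) ∷ [])
          where
          dv : depth v ≡ suc (depth u)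
          dv = ≤-antisym (depth-adj a) du<dv
          v≢root = deep⇒≢root dv
          dpv = trans (depth-parent v) (cong pred dv)

      adj⇒parent-edge : ∀ {u v} → Adj G u v → ParentEdge u v
      adj⇒parent-edge {u} {v} a with ≤-total (depth u) (depth v)
      ... | inj₁ u≤v = downward-adj⇒parent-edge a u≤v
      ... | inj₂ v≤u = Sum.swap (downward-adj⇒parent-edge (adj-sym a) v≤u)

      deepest-leaf : ∀ {x} → Adj G deepest x → x ≡ parent deepest
      deepest-leaf {x} a with adj⇒parent-edge a
      ... | inj₁ pℓ≡x = ≡.sym pℓ≡x
      ... | inj₂ px≡ℓ = ⊥-elim (1+n≰n (subst (_≤ depth deepest) (depth-child a px≡ℓ) (depth≤deepest x)))

      ancestor-of-child : ∀ {c x y} → ProperAncestor c x → Adj G x y → parent y ≡ x → ProperAncestor c y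
      ancestor-of-child (proper-ancestor g e anc) a refl =
        proper-ancestor (suc g) (trans (depth-child a refl) (cong suc e)) anc

      ancestor-of-parent : ∀ {c x y} → ProperAncestor c y → parent y ≡ x → x ≢ c → ProperAncestor c x
      ancestor-of-parent (proper-ancestor zero    _ anc) refl x≢c = ⊥-elim (x≢c anc)
      ancestor-of-parent {y = y} (proper-ancestor (suc g) e anc) refl _ =
        proper-ancestor g (trans (depth-parent y) (cong pred e)) anc

      ancestor-step : ∀ {c r r₁} → ProperAncestor c r → Step G r r₁ → r₁ ≢ c → ProperAncestor c r₁
      ancestor-step pa (inj₁ refl) _ = pa
      ancestor-step pa (inj₂ a) r₁≢c with adj⇒parent-edge a
      ... | inj₁ pr≡r₁ = ancestor-of-parent pa pr≡r₁ r₁≢c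
      ... | inj₂ pr₁≡r = ancestor-of-child pa a pr₁≡r

      hidden-childTowards : ∀ {c r r₁} → ProperAncestor c r → Step G r r₁ → Adj G c r₁ →
                            r₁ ≡ childTowards c r
      hidden-childTowards {c} {r} {r₁} pa st a with adj⇒parent-edge a
      ... | inj₁ pc≡r₁ = ⊥-elim (<-asym (ancestor-deeper (ancestor-step pa st (adj⇒≢ a ∘ ≡.sym)))
                                        (≤-reflexive (≡.sym (depth-child (adj-sym a) pc≡r₁))))
      ... | inj₂ pr₁≡c with st
      ...   | inj₁ refl = ≡.sym (childTowards-at 0 (depth-child a pr₁≡c))
      ...   | inj₂ b with adj⇒parent-edge b
      ...     | inj₁ pr≡r₁ = trans (≡.sym pr≡r₁)
                  (≡.sym (childTowards-at 1
                    (trans (depth-child (adj-sym b) pr≡r₁) (cong suc (depth-child a pr₁≡c)))))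
      ...     | inj₂ pr₁≡r = ⊥-elim (<-irrefl (cong depth (trans (≡.sym pr₁≡c) pr₁≡r)) (ancestor-deeper pa))

  -- Catching the robber on a tree

  module Hunt {ℓ q : Fin n} (T : BreadthFirstTree ℓ) (acyclic : ¬ Cycle G)
              (leaf : ∀ {x} → Adj G ℓ x → x ≡ q) where
    open BreadthFirstTree T
    open InTree T
    open Acyclic acyclic

    locate : Fin n → Fin n → Obs G 1 → Fin n
    locate c r (just x) = x
    locate c r nothing  = childTowards c r

    -- track (oₜ ∷ … ∷ o₀) pairs the cop's position at time t + 1 with the robber's position at
    -- time t; track [] pairs the cop's start ℓ with the only vertex where he can hide from it.
    track : List (Obs G 1) → Fin n × Fin n
    track []      = ℓ , q
    track (o ∷ h) = childTowards c r₁ , r₁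
      where
      c  = proj₁ (track h)
      r₁ = locate c (proj₂ (track h)) o

    hunter : Strategy G 1
    hunter = record { start = λ _ → ℓ ; move = λ h _ → proj₁ (track h) }

    locate-observe : ∀ {c : Config G 1} {r x} → (Adj G (c zero) x → x ≡ childTowards (c zero) r) →
                     locate (c zero) r (observe G 1 c x) ≡ x
    locate-observe {c} {r} {x} hidden = by-visibility (T? (adj G (c zero) x))
      where
      by-visibility : Dec (Adj G (c zero) x) → locate (c zero) r (observe G 1 c x) ≡ x
      by-visibility (yes a)  = trans (cong (locate (c zero) r) (observe-hidden a)) (≡.sym (hidden a))
      by-visibility (no  na) = cong (locate (c zero) r) (observe-visible na)

    module _ (r : ℕ → Fin n) (walk : RobberWalk G 1 r) where
      open Play G 1 hunter r

      cop : ℕ → Fin n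
      cop t = cops t zero

      estimate : ℕ → Fin n
      estimate t = proj₂ (track (hist t))

      cop-suc : ∀ t → cop (suc t) ≡ childTowards (cop t) (estimate t)
      cop-suc zero    = refl
      cop-suc (suc t) = refl

      Captured : ℕ → Set
      Captured N = Σ ℕ λ t → t ≤ N × Caught t × (∀ s → s < t → LegalCopMove s)

      record Cornered (t : ℕ) : Set where
        field
          depth-cop      : depth (cop t) ≡ t
          estimate-exact : estimate t ≡ r t
          below          : ProperAncestor (cop t) (r t)
          legal          : ∀ s → s < t → LegalCopMove s

      start-cornered : Captured 0 ⊎ Cornered 0
      start-cornered with r 0 ≟ ℓ
      ... | yes r₀≡ℓ = inj₁ (0 , z≤n , (zero , inj₁ (≡.sym r₀≡ℓ)) , λ _ ())
      ... | no  r₀≢ℓ = inj₂ record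
        { depth-cop      = depth-root
        ; estimate-exact = locate-observe hidden-start
        ; below          = root-ancestor r₀≢ℓ
        ; legal          = λ _ ()
        }
        where
        hidden-start : Adj G ℓ (r 0) → r 0 ≡ childTowards ℓ q
        hidden-start a with leaf a
        ... | refl = hidden-childTowards (root-ancestor r₀≢ℓ) (inj₁ refl) a

      round : ∀ t → Cornered t → Captured (suc t) ⊎ Cornered (suc t)
      round t inv = settle (cop (suc t) ≟ r t) (cop (suc t) ≟ r (suc t))
        where
        open Cornered inv

        chased : cop (suc t) ≡ childTowards (cop t) (r t)
        chased = trans (cop-suc t) (cong (childTowards (cop t)) estimate-exact)

        legal₁ : ∀ s → s < suc t → LegalCopMove s
        legal₁ s s<1+t with m≤n⇒m<n∨m≡n (≤-pred s<1+t)
        ... | inj₁ s<t  = legal s s<t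
        ... | inj₂ refl = λ { zero → inj₂ (subst (Adj G (cop t)) (≡.sym chased) (adj-childTowards below)) }

        settle : Dec (cop (suc t) ≡ r t) → Dec (cop (suc t) ≡ r (suc t)) →
                 Captured (suc t) ⊎ Cornered (suc t)
        settle (yes caught) _            = inj₁ (suc t , ≤-refl , (zero , inj₂ caught) , legal₁)
        settle (no _)       (yes caught) = inj₁ (suc t , ≤-refl , (zero , inj₁ caught) , legal₁)
        settle (no missed)  (no missed₁) = inj₂ record
          { depth-cop      = trans (cong depth chased) (trans (depth-childTowards below) (cong suc depth-cop))
          ; estimate-exact = trans (cong (λ e → locate (cop (suc t)) e seen) estimate-exact)
                                   (locate-observe (hidden-childTowards below₁ (walk t)))
          ; below          = below₂
          ; legal          = legal₁
          }
          where
          seen = observe G 1 (cops (suc t)) (r (suc t))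
          below₁ : ProperAncestor (cop (suc t)) (r t)
          below₁ = subst (λ c → ProperAncestor c (r t)) (≡.sym chased)
                     (childTowards-ancestor below (missed ∘ trans chased))
          below₂ : ProperAncestor (cop (suc t)) (r (suc t))
          below₂ = ancestor-step below₁ (walk t) (missed₁ ∘ ≡.sym)

      progress : ∀ t → Captured t ⊎ Cornered t
      progress zero    = start-cornered
      progress (suc t) with progress t
      ... | inj₁ (s , s≤t , caught , legal) = inj₁ (s , m≤n⇒m≤1+n s≤t , caught , legal)
      ... | inj₂ inv                        = round t inv

      captured : Captured (depth deepest)
      captured with progress (depth deepest)
      ... | inj₁ done = done
      ... | inj₂ inv  = ⊥-elim (1+n≰n (≤-trans (subst (_< depth (r h)) depth-cop (ancestor-deeper below))
                                               (depth≤deepest (r h))))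
        where
        h = depth deepest
        open Cornered inv

    hunter-wins : CopsWin G 1
    hunter-wins = hunter , depth deepest , captured

  acyclic⇒CopsWin : Connected G → ¬ Cycle G → Fin n → CopsWin G 1
  acyclic⇒CopsWin connected acyclic v =
    Hunt.hunter-wins (BreadthFirstSearch.tree connected ℓ) acyclic (InTree.Acyclic.deepest-leaf T₀ acyclic)
    where
    T₀ = BreadthFirstSearch.tree connected v
    ℓ  = InTree.deepest T₀

  ¬CopsWin-0 : Fin n → ¬ CopsWin G 0
  ¬CopsWin-0 v (_ , _ , wins) with wins (λ _ → v) (λ _ → inj₁ refl)
  ... | _ , _ , (() , _) , _

mainTheorem1 : ∀ {n : ℕ} (G : Graph n) → 1 ≤ n → Connected G →
    (HyperopicCopNumber G 1 ⇔ IsTree G)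
mainTheorem1 {suc _} G _ connected = mk⇔
  (λ (oneWins , _) → connected , λ C → cycle⇒¬CopsWin G C oneWins)
  (λ (_ , acyclic) → acyclic⇒CopsWin G connected acyclic zero , fewer)
  where
  fewer : ∀ j → j < 1 → ¬ CopsWin G j
  fewer zero    _        = ¬CopsWin-0 G zero
  fewer (suc _) (s≤s ())
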